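{- Let $G=\{g_1:=0,g_2,\ldots,g_n\}$ be a finite Abelian group of odd order $n\ge5$. Let ${\boldsymbol e}_1,\dots,{\boldsymbol e}_n$ be the standard basis of $\mathbb{R}^n$, ${\boldsymbol f}_i={\boldsymbol e}_1-{\boldsymbol e}_{i+1}$ for $i=1,\dots,n-1$, and let $A\in\mathbb{R}^{n\times(n-1)}$ be the matrix whose $i$-th column is ${\boldsymbol f}_i$, with entries $A_{a,j}$. For $z\in G$ let $R_z=\{(a,b)\in\{1,\dots,n\}^2:\ g_a+g_b=z,\ a\ne b\}$, and for $j,k\in\{1,\dots,n-1\}$ and $a,b,c,d\in\{1,\dots,n\}$ put $$f_{j,k}(a,b,c,d)=(A_{a,j}+A_{b,j}-A_{c,j}-A_{d,j})(A_{a,k}+A_{b,k}-A_{c,k}-A_{d,k}).$$ Then for all $j,k\in\{1,\dots,n-1\}$, $$\sum_{z\in G}\ \sum_{(a,b)\in R_z}\ \sum_{(c,d)\in R_z} f_{j,k}(a,b,c,d)=4n(n-3)\,({\boldsymbol f}_j,{\boldsymbol f}_k),$$ where $(\cdot,\cdot)$ is the standard dot product. -}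

module Defs where

open import Data.Nat as ℕ using (ℕ; zero; suc)
open import Data.Fin using (Fin; toℕ) renaming (zero to fzero; suc to fsuc)
open import Data.Fin.Properties using (_≟_)
open import Data.Integer using (ℤ; +_; _+_; _-_; _*_)
open import Relation.Nullary using (yes; no; ¬_)
open import Relation.Binary.PropositionalEquality using (_≡_)

Σ[_] : (n : ℕ) → (Fin n → ℤ) → ℤ
Σ[ zero ] f = + 0
Σ[ suc n ] f = f fzero + Σ[ n ] (λ i → f (fsuc i))

[_≡ℕ_] : ℕ → ℕ → ℤ
[ m ≡ℕ k ] with m ℕ.≟ k
... | yes _ = + 1
... | no _  = + 0

-- Entries of A (0-based indices): row a ∈ Fin n (a ↔ a+1 in the paper),
-- column j ∈ Fin (n ∸ 1) (j ↔ j+1 in the paper).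
A : (n : ℕ) → Fin n → Fin (n ℕ.∸ 1) → ℤ
A n a j = [ toℕ a ≡ℕ 0 ] - [ toℕ a ≡ℕ suc (toℕ j) ]

dotCol : (n : ℕ) → Fin (n ℕ.∸ 1) → Fin (n ℕ.∸ 1) → ℤ
dotCol n j k = Σ[ n ] (λ a → A n a j * A n a k)

fjk : (n : ℕ) → Fin (n ℕ.∸ 1) → Fin (n ℕ.∸ 1) → Fin n → Fin n → Fin n → Fin n → ℤ
fjk n j k a b c d =
  (A n a j + A n b j - A n c j - A n d j) * (A n a k + A n b k - A n c k - A n d k)

-- Sum over (a,b) ∈ R_z = {(a,b) : g_a + g_b = z, a ≠ b}, for the group
-- operation _∙_ on the carrier Fin n (element a of Fin n is g_{a+1}).
ΣR : (n : ℕ) → (Fin n → Fin n → Fin n) → Fin n → (Fin n → Fin n → ℤ) → ℤ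
ΣR n _∙_ z h = Σ[ n ] (λ a → Σ[ n ] (λ b → term a b))
  where
  term : Fin n → Fin n → ℤ
  term a b with a ≟ b | (a ∙ b) ≟ z
  ... | no _  | yes _ = h a b
  ... | _     | _     = + 0

LHS : (n : ℕ) → (Fin n → Fin n → Fin n) → Fin (n ℕ.∸ 1) → Fin (n ℕ.∸ 1) → ℤ
LHS n _∙_ j k =
  Σ[ n ] (λ z → ΣR n _∙_ z (λ a b → ΣR n _∙_ z (λ c d → fjk n j k a b c d)))

-- The set R_z is the graph {(a, a⁻¹z)} of an involution of G with the single diagonal point
-- (√z, √z) removed: in a group of odd order squaring is injective (an element x ≠ ε with
-- x² = ε would make c ↦ cx a fixed-point-free involution, forcing n to be even), hence a
-- bijection. Summation over R_z is therefore a linear functional L with L(1) = n − 1, and every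
-- linear functional satisfies Σ_{x,y} (p x − p y)(q x − q y) = 2 (L(1) L(pq) − L(p) L(q)).
-- For p(a,b) = w_a + w_b with w a column of A, which sums to 0, this gives
-- L(p) = −2 w(√z) and L(pq) = Σ_a p(a, a⁻¹z) q(a, a⁻¹z) − 4 w(√z) w′(√z). Summing over z,
-- Σ_z Σ_a p(a, a⁻¹z) q(a, a⁻¹z) = Σ_{a,b} (w_a + w_b)(w′_a + w′_b) = 2n (f_j, f_k) and
-- Σ_z w(√z) w′(√z) = (f_j, f_k), so the total is (2(n − 1) · 2n − 8n) (f_j, f_k).

module Submission where

open import Defs
open import Data.Nat as ℕ using (ℕ; zero; suc; _≤_; _∸_)
import Data.Nat.Properties as ℕ
open import Data.Nat.Divisibility using (_∣_; 1∣_)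
import Data.Integer.Divisibility as ℤ
open import Data.Integer.Divisibility using () renaming (_∣_ to _∣ℤ_)
open import Data.Fin using (Fin; toℕ; _<?_; punchOut) renaming (zero to fzero; suc to fsuc)
open import Data.Fin.Permutation using (permutation)
open import Data.Fin.Properties
  using (toℕ-injective; suc-injective; _≟_; ≤-antisym; <⇒≢; any?; pigeonhole; punchOut-injective)
open import Data.Integer using (ℤ; +_; _+_; _-_; _*_; -_; ∣_∣)
open import Data.Integer.Properties
  using (+-0-commutativeMonoid; +-identityʳ; +-identityˡ; *-identityˡ; *-zeroʳ; *-comm; *-distribˡ-+)
open import Data.Integer.Tactic.RingSolver using (solve-∀)
open import Data.Product using (_×_; _,_; proj₁; proj₂; curry)
open import Function using (_∘_; flip)
open import Function.Definitions using (Injective; Surjective)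
open import Relation.Nullary using (yes; no; ¬_; contradiction)
open import Level using (0ℓ)
open import Algebra.Bundles using (AbelianGroup; Group)
open import Algebra.Structures using (IsAbelianGroup)
import Relation.Binary.PropositionalEquality as ≡
open ≡ using (_≡_; _≢_; refl; sym; trans; cong₂; subst; module ≡-Reasoning)
open import Algebra.Properties.CommutativeMonoid.Sum +-0-commutativeMonoid
  using (sum; sum-cong-≗; ∑-comm; sum-permute)

open ≡-Reasoning

record IsLinear {I : Set} (L : (I → ℤ) → ℤ) : Set where
  field
    cong   : ∀ {f g} → (∀ i → f i ≡ g i) → L f ≡ L g
    +-homo : ∀ f g → L (λ i → f i + g i) ≡ L f + L g
    *-homo : ∀ c f → L (λ i → c * f i) ≡ c * L f

  sub-homo : ∀ f g → L (λ i → f i - g i) ≡ L f - L g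
  sub-homo f g = begin
    L (λ i → f i - g i)          ≡⟨ cong (λ i → ≡.cong (_+_ (f i)) (neg≡-1* (g i))) ⟩
    L (λ i → f i + - + 1 * g i)  ≡⟨ +-homo f _ ⟩
    L f + L (λ i → - + 1 * g i)  ≡⟨ ≡.cong (_+_ (L f)) (*-homo (- + 1) g) ⟩
    L f + - + 1 * L g            ≡⟨ ≡.cong (_+_ (L f)) (sym (neg≡-1* (L g))) ⟩
    L f - L g                    ∎
    where
    neg≡-1* : ∀ x → - x ≡ - + 1 * x
    neg≡-1* = solve-∀

module _ {I : Set} where

  isLinear-eval : ∀ i → IsLinear {I} (λ f → f i)
  isLinear-eval i = record
    { cong = λ f≗g → f≗g i ; +-homo = λ _ _ → refl ; *-homo = λ _ _ → refl }

  isLinear-resp : ∀ {L M : (I → ℤ) → ℤ} → (∀ f → L f ≡ M f) → IsLinear M → IsLinear L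
  isLinear-resp {L} {M} L≗M isM = record
    { cong   = λ {f} {g} f≗g → trans (L≗M f) (trans (M.cong f≗g) (sym (L≗M g)))
    ; +-homo = λ f g → trans (L≗M _) (trans (M.+-homo f g) (sym (cong₂ _+_ (L≗M f) (L≗M g))))
    ; *-homo = λ c f → trans (L≗M _) (trans (M.*-homo c f) (sym (≡.cong (c *_) (L≗M f))))
    }
    where module M = IsLinear isM

  isLinear-sub : ∀ {L M : (I → ℤ) → ℤ} → IsLinear L → IsLinear M → IsLinear (λ f → L f - M f)
  isLinear-sub {L} {M} isL isM = record
    { cong   = λ f≗g → cong₂ _-_ (L.cong f≗g) (M.cong f≗g)
    ; +-homo = λ f g → trans (cong₂ _-_ (L.+-homo f g) (M.+-homo f g)) (regroup (L f) (L g) (M f) (M g))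
    ; *-homo = λ c f → trans (cong₂ _-_ (L.*-homo c f) (M.*-homo c f)) (factor c (L f) (M f))
    }
    where
    module L = IsLinear isL
    module M = IsLinear isM
    regroup : ∀ a b c d → (a + b) - (c + d) ≡ (a - c) + (b - d)
    regroup = solve-∀
    factor : ∀ c a b → c * a - c * b ≡ c * (a - b)
    factor = solve-∀

isLinear-∘ : ∀ {I J : Set} {L : (I → ℤ) → ℤ} → IsLinear L → (φ : I → J) →
  IsLinear (λ (f : J → ℤ) → L (f ∘ φ))
isLinear-∘ isL φ = record
  { cong = λ f≗g → L.cong (f≗g ∘ φ) ; +-homo = λ _ _ → L.+-homo _ _ ; *-homo = λ c _ → L.*-homo c _ }
  where module L = IsLinear isL

_⊗_ : {I J : Set} → ((I → ℤ) → ℤ) → ((J → ℤ) → ℤ) → (I × J → ℤ) → ℤ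
(L ⊗ M) h = L (λ i → M (λ j → h (i , j)))

module _ {I J : Set} {L : (I → ℤ) → ℤ} {M : (J → ℤ) → ℤ}
         (isL : IsLinear L) (isM : IsLinear M) where
  private
    module L = IsLinear isL
    module M = IsLinear isM

  isLinear-⊗ : IsLinear (L ⊗ M)
  isLinear-⊗ = record
    { cong   = λ f≗g → L.cong (λ i → M.cong (λ j → f≗g (i , j)))
    ; +-homo = λ f g → trans (L.cong (λ i → M.+-homo _ _)) (L.+-homo _ _)
    ; *-homo = λ c f → trans (L.cong (λ i → M.*-homo c _)) (L.*-homo c _)
    }

  ⊗-* : ∀ f g → (L ⊗ M) (λ (i , j) → f i * g j) ≡ L f * M g
  ⊗-* f g = begin
    L (λ i → M (λ j → f i * g j))  ≡⟨ L.cong (λ i → M.*-homo (f i) g) ⟩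
    L (λ i → f i * M g)            ≡⟨ L.cong (λ i → *-comm (f i) (M g)) ⟩
    L (λ i → M g * f i)            ≡⟨ L.*-homo (M g) f ⟩
    M g * L f                      ≡⟨ *-comm (M g) (L f) ⟩
    L f * M g                      ∎

module _ {I : Set} {L : (I → ℤ) → ℤ} (isL : IsLinear L) where
  private
    module L² = IsLinear (isLinear-⊗ isL isL)

  ⊗-symmetric-* : ∀ f g → (L ⊗ L) (λ (x , y) → f x * g y + g x * f y) ≡ + 2 * (L f * L g)
  ⊗-symmetric-* f g = begin
    (L ⊗ L) (λ (x , y) → f x * g y + g x * f y)
      ≡⟨ L².+-homo (λ (x , y) → f x * g y) (λ (x , y) → g x * f y) ⟩
    (L ⊗ L) (λ (x , y) → f x * g y) + (L ⊗ L) (λ (x , y) → g x * f y)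
      ≡⟨ cong₂ _+_ (⊗-* isL isL f g) (⊗-* isL isL g f) ⟩
    L f * L g + L g * L f
      ≡⟨ double-commuted (L f) (L g) ⟩
    + 2 * (L f * L g) ∎
    where
    double-commuted : ∀ x y → x * y + y * x ≡ + 2 * (x * y)
    double-commuted = solve-∀

  ⊗-difference-product : ∀ p q →
    (L ⊗ L) (λ (x , y) → (p x - p y) * (q x - q y))
      ≡ + 2 * (L (λ _ → + 1) * L (λ x → p x * q x)) - + 2 * (L p * L q)
  ⊗-difference-product p q = begin
    (L ⊗ L) (λ (x , y) → (p x - p y) * (q x - q y))
      ≡⟨ L².cong (λ (x , y) → expand (p x) (p y) (q x) (q y)) ⟩
    (L ⊗ L) (λ (x , y) → (+ 1 * pq y + pq x * + 1) - (p x * q y + q x * p y))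
      ≡⟨ L².sub-homo (λ (x , y) → + 1 * pq y + pq x * + 1) (λ (x , y) → p x * q y + q x * p y) ⟩
    (L ⊗ L) (λ (x , y) → + 1 * pq y + pq x * + 1) - (L ⊗ L) (λ (x , y) → p x * q y + q x * p y)
      ≡⟨ cong₂ _-_ (⊗-symmetric-* (λ _ → + 1) pq) (⊗-symmetric-* p q) ⟩
    + 2 * (L (λ _ → + 1) * L pq) - + 2 * (L p * L q) ∎
    where
    pq : I → ℤ
    pq x = p x * q x
    expand : ∀ a b c d → (a - b) * (c - d) ≡ (+ 1 * (b * d) + a * c * + 1) - (a * d + c * b)
    expand = solve-∀

  ⊗-sum-product : ∀ p q →
    (L ⊗ L) (λ (x , y) → (p x + p y) * (q x + q y))
      ≡ + 2 * (L (λ _ → + 1) * L (λ x → p x * q x)) + + 2 * (L p * L q)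
  ⊗-sum-product p q = begin
    (L ⊗ L) (λ (x , y) → (p x + p y) * (q x + q y))
      ≡⟨ L².cong (λ (x , y) → expand (p x) (p y) (q x) (q y)) ⟩
    (L ⊗ L) (λ (x , y) → (+ 1 * pq y + pq x * + 1) + (p x * q y + q x * p y))
      ≡⟨ L².+-homo (λ (x , y) → + 1 * pq y + pq x * + 1) (λ (x , y) → p x * q y + q x * p y) ⟩
    (L ⊗ L) (λ (x , y) → + 1 * pq y + pq x * + 1) + (L ⊗ L) (λ (x , y) → p x * q y + q x * p y)
      ≡⟨ cong₂ _+_ (⊗-symmetric-* (λ _ → + 1) pq) (⊗-symmetric-* p q) ⟩
    + 2 * (L (λ _ → + 1) * L pq) + + 2 * (L p * L q) ∎
    where
    pq : I → ℤ
    pq x = p x * q x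
    expand : ∀ a b c d → (a + b) * (c + d) ≡ (+ 1 * (b * d) + a * c * + 1) + (a * d + c * b)
    expand = solve-∀

isLinear-Σ : ∀ {n} → IsLinear (Σ[ n ])
isLinear-Σ = record { cong = Σ-cong ; +-homo = Σ-+ ; *-homo = Σ-* }
  where
  Σ-cong : ∀ {n} {f g : Fin n → ℤ} → (∀ i → f i ≡ g i) → Σ[ n ] f ≡ Σ[ n ] g
  Σ-cong {zero}  f≗g = refl
  Σ-cong {suc n} f≗g = cong₂ _+_ (f≗g fzero) (Σ-cong (f≗g ∘ fsuc))

  Σ-+ : ∀ {n} (f g : Fin n → ℤ) → Σ[ n ] (λ i → f i + g i) ≡ Σ[ n ] f + Σ[ n ] g
  Σ-+ {zero}  f g = refl
  Σ-+ {suc n} f g =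
    trans (≡.cong (_+_ (f fzero + g fzero)) (Σ-+ (f ∘ fsuc) (g ∘ fsuc)))
          (interchange (f fzero) (g fzero) _ _)
    where
    interchange : ∀ a b c d → (a + b) + (c + d) ≡ (a + c) + (b + d)
    interchange = solve-∀

  Σ-* : ∀ {n} c (f : Fin n → ℤ) → Σ[ n ] (λ i → c * f i) ≡ c * Σ[ n ] f
  Σ-* {zero}  c f = sym (*-zeroʳ c)
  Σ-* {suc n} c f =
    trans (≡.cong (_+_ (c * f fzero)) (Σ-* c (f ∘ fsuc))) (sym (*-distribˡ-+ c _ _))

module Σ {n : ℕ} = IsLinear (isLinear-Σ {n})

Σ-one : ∀ n → Σ[ n ] (λ _ → + 1) ≡ + n
Σ-one zero    = refl
Σ-one (suc n) = ≡.cong (_+_ (+ 1)) (Σ-one n)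

Σ-zero : ∀ {n} {f : Fin n → ℤ} → (∀ i → f i ≡ + 0) → Σ[ n ] f ≡ + 0
Σ-zero {zero}  f≗0 = refl
Σ-zero {suc n} f≗0 = cong₂ _+_ (f≗0 fzero) (Σ-zero (f≗0 ∘ fsuc))

Σ-single : ∀ {n} (f : Fin n → ℤ) c → (∀ i → i ≢ c → f i ≡ + 0) → Σ[ n ] f ≡ f c
Σ-single f fzero    off-c = trans (≡.cong (_+_ (f fzero)) (Σ-zero (λ i → off-c (fsuc i) λ ())))
                                  (+-identityʳ (f fzero))
Σ-single f (fsuc c) off-c = trans (cong₂ _+_ (off-c fzero λ ())
                                             (Σ-single (f ∘ fsuc) c (λ i i≢c → off-c (fsuc i) (i≢c ∘ suc-injective))))
                                  (+-identityˡ (f (fsuc c)))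

Σ≡sum : ∀ {n} (f : Fin n → ℤ) → Σ[ n ] f ≡ sum f
Σ≡sum {zero}  f = refl
Σ≡sum {suc n} f = ≡.cong (_+_ (f fzero)) (Σ≡sum (f ∘ fsuc))

Σ-comm : ∀ {m n} (f : Fin m → Fin n → ℤ) →
  Σ[ m ] (λ a → Σ[ n ] (f a)) ≡ Σ[ n ] (λ b → Σ[ m ] (λ a → f a b))
Σ-comm f = begin
  Σ[ _ ] (λ a → Σ[ _ ] (f a))        ≡⟨ Σ²≡sum² f ⟩
  sum (λ a → sum (f a))              ≡⟨ ∑-comm f ⟩
  sum (λ b → sum (λ a → f a b))      ≡⟨ sym (Σ²≡sum² (flip f)) ⟩
  Σ[ _ ] (λ b → Σ[ _ ] (λ a → f a b)) ∎
  where
  Σ²≡sum² : ∀ {m n} (g : Fin m → Fin n → ℤ) → Σ[ m ] (λ a → Σ[ n ] (g a)) ≡ sum (λ a → sum (g a))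
  Σ²≡sum² g = trans (Σ≡sum (λ a → Σ[ _ ] (g a))) (sum-cong-≗ (λ a → Σ≡sum (g a)))

Σ-reindex : ∀ {n} (φ ψ : Fin n → Fin n) → (∀ a → φ (ψ a) ≡ a) → (∀ a → ψ (φ a) ≡ a) →
  (f : Fin n → ℤ) → Σ[ n ] (f ∘ φ) ≡ Σ[ n ] f
Σ-reindex φ ψ φψ ψφ f = begin
  Σ[ _ ] (f ∘ φ)  ≡⟨ Σ≡sum (f ∘ φ) ⟩
  sum (f ∘ φ)     ≡⟨ sym (sum-permute f (permutation φ ψ φψ ψφ)) ⟩
  sum f           ≡⟨ sym (Σ≡sum f) ⟩
  Σ[ _ ] f        ∎

δ : ∀ {n} → Fin n → Fin n → ℤ
δ a b = [ toℕ a ≡ℕ toℕ b ]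

δ-refl : ∀ {n} (a : Fin n) → δ a a ≡ + 1
δ-refl a with toℕ a ℕ.≟ toℕ a
... | yes _    = refl
... | no  a≢a  = contradiction refl a≢a

δ-≢ : ∀ {n} {a b : Fin n} → a ≢ b → δ a b ≡ + 0
δ-≢ {a = a} {b} a≢b with toℕ a ℕ.≟ toℕ b
... | yes a≡b = contradiction (toℕ-injective a≡b) a≢b
... | no  _   = refl

Σ-δ-one : ∀ {n} (c : Fin n) → Σ[ n ] (λ a → δ a c) ≡ + 1
Σ-δ-one c = trans (Σ-single (λ a → δ a c) c (λ _ → δ-≢)) (δ-refl c)

Σ-δ : ∀ {n} c (f : Fin n → ℤ) → Σ[ n ] (λ a → δ a c * f a) ≡ f c
Σ-δ c f = begin
  Σ[ _ ] (λ a → δ a c * f a)  ≡⟨ Σ-single _ c (λ a a≢c → ≡.cong (_* f a) (δ-≢ a≢c)) ⟩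
  δ c c * f c                 ≡⟨ ≡.cong (_* f c) (δ-refl c) ⟩
  + 1 * f c                   ≡⟨ *-identityˡ (f c) ⟩
  f c                         ∎

fixed-point-free-involution⇒2∣n : ∀ {n} (σ : Fin n → Fin n) →
  (∀ a → σ (σ a) ≡ a) → (∀ a → σ a ≢ a) → 2 ∣ n
fixed-point-free-involution⇒2∣n {n} σ σσ≗id σa≢a =
  subst (+ 2 ∣ℤ_) (sym n≡2S) (ℤ.*-monoʳ-∣ (+ 2) {+ 1} {S} (1∣ ∣ S ∣))
  where
  ascending : Fin n → Fin n → ℤ
  ascending a b with a <? b
  ... | yes _ = + 1
  ... | no  _ = + 0

  ascending-≢ : ∀ {a b} → a ≢ b → ascending a b + ascending b a ≡ + 1
  ascending-≢ {a} {b} a≢b with a <? b | b <? a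
  ... | yes a<b | yes b<a = contradiction b<a (ℕ.<-asym a<b)
  ... | yes _   | no  _   = refl
  ... | no  _   | yes _   = refl
  ... | no  a≮b | no  b≮a = contradiction (≤-antisym (ℕ.≮⇒≥ b≮a) (ℕ.≮⇒≥ a≮b)) a≢b

  ascent : Fin n → ℤ
  ascent a = ascending a (σ a)

  S : ℤ
  S = Σ[ n ] ascent

  n≡2S : + n ≡ + 2 * S
  n≡2S = begin
    + n                                      ≡⟨ sym (Σ-one n) ⟩
    Σ[ n ] (λ _ → + 1)                       ≡⟨ Σ.cong (λ a → sym (ascending-≢ (σa≢a a ∘ sym))) ⟩
    Σ[ n ] (λ a → ascent a + ascending (σ a) a)
      ≡⟨ Σ.cong (λ a → ≡.cong (λ b → ascent a + ascending (σ a) b) (sym (σσ≗id a))) ⟩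
    Σ[ n ] (λ a → ascent a + ascent (σ a))  ≡⟨ Σ.+-homo ascent (ascent ∘ σ) ⟩
    S + Σ[ n ] (ascent ∘ σ)                  ≡⟨ ≡.cong (_+_ S) (Σ-reindex σ σ σσ≗id σσ≗id ascent) ⟩
    S + S                                    ≡⟨ double S ⟩
    + 2 * S                                  ∎
    where
    double : ∀ x → x + x ≡ + 2 * x
    double = solve-∀

injective⇒surjective : ∀ {n} (f : Fin n → Fin n) → Injective _≡_ _≡_ f → Surjective _≡_ _≡_ f
injective⇒surjective {suc n} f f-inj z with any? (λ a → f a ≟ z)
... | yes (a , fa≡z) = a , λ { refl → fa≡z }
... | no  ∄a =
  let i , j , i<j , squeeze-i≡squeeze-j = pigeonhole (ℕ.n<1+n n) squeeze
  in contradiction (f-inj (punchOut-injective (misses i) (misses j) squeeze-i≡squeeze-j)) (<⇒≢ i<j)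
  where
  misses : ∀ a → z ≢ f a
  misses a z≡fa = ∄a (a , sym z≡fa)
  squeeze : Fin (suc n) → Fin n
  squeeze a = punchOut (misses a)

module OddOrderAbelianGroup {n : ℕ} (odd : ¬ 2 ∣ n)
  {_∙_ : Fin n → Fin n → Fin n} {ε : Fin n} {_⁻¹ : Fin n → Fin n}
  (isAbelianGroup : IsAbelianGroup _≡_ _∙_ ε _⁻¹) where

  G : AbelianGroup 0ℓ 0ℓ
  G = record { isAbelianGroup = isAbelianGroup }

  open AbelianGroup G using (comm; inverseʳ; identityʳ; assoc)
  open Group (AbelianGroup.group G) using (_\\_)
  open import Algebra.Properties.AbelianGroup G
    using (quasigroup; \\-leftDividesˡ; \\-leftDividesʳ; ⁻¹-∙-comm; x∙y⁻¹≈ε⇒x≈y; identityʳ-unique)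
  open import Algebra.Properties.Quasigroup quasigroup using (y≈x\\z)
  open import Algebra.Properties.CommutativeSemigroup (AbelianGroup.commutativeSemigroup G)
    using (interchange)

  \\-involutive : ∀ z a → (a \\ z) \\ z ≡ a
  \\-involutive z a = sym (y≈x\\z (a \\ z) a z (trans (comm (a \\ z) a) (\\-leftDividesˡ a z)))

  x∙x≡ε⇒x≡ε : ∀ x → x ∙ x ≡ ε → x ≡ ε
  x∙x≡ε⇒x≡ε x x∙x≡ε with x ≟ ε
  ... | yes x≡ε = x≡ε
  ... | no  x≢ε = contradiction (fixed-point-free-involution⇒2∣n (_∙ x) ∙x-involutive ∙x-fixes-nothing) odd
    where
    ∙x-involutive : ∀ a → (a ∙ x) ∙ x ≡ a
    ∙x-involutive a = trans (assoc a x x) (trans (≡.cong (a ∙_) x∙x≡ε) (identityʳ a))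
    ∙x-fixes-nothing : ∀ a → a ∙ x ≢ a
    ∙x-fixes-nothing a a∙x≡a = x≢ε (identityʳ-unique a x a∙x≡a)

  square-injective : Injective _≡_ _≡_ (λ a → a ∙ a)
  square-injective {a} {b} a∙a≡b∙b = x∙y⁻¹≈ε⇒x≈y a b (x∙x≡ε⇒x≡ε (a ∙ (b ⁻¹)) (begin
    (a ∙ (b ⁻¹)) ∙ (a ∙ (b ⁻¹))  ≡⟨ interchange a (b ⁻¹) a (b ⁻¹) ⟩
    (a ∙ a) ∙ ((b ⁻¹) ∙ (b ⁻¹))  ≡⟨ cong₂ _∙_ a∙a≡b∙b (⁻¹-∙-comm b b) ⟩
    (b ∙ b) ∙ ((b ∙ b) ⁻¹)       ≡⟨ inverseʳ (b ∙ b) ⟩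
    ε                            ∎))

  √ : Fin n → Fin n
  √ z = proj₁ (injective⇒surjective (λ a → a ∙ a) square-injective z)

  √-squared : ∀ z → √ z ∙ √ z ≡ z
  √-squared z = proj₂ (injective⇒surjective (λ a → a ∙ a) square-injective z) refl

  √-of-square : ∀ a → √ (a ∙ a) ≡ a
  √-of-square a = square-injective (√-squared (a ∙ a))

  √-\\ : ∀ z → √ z \\ z ≡ √ z
  √-\\ z = sym (y≈x\\z (√ z) (√ z) z (√-squared z))

  \\-fixed⇒√ : ∀ {z a} → a \\ z ≡ a → a ≡ √ z
  \\-fixed⇒√ {z} {a} a\\z≡a = begin
    a                 ≡⟨ sym (√-of-square a) ⟩
    √ (a ∙ a)         ≡⟨ ≡.cong (λ b → √ (a ∙ b)) (sym a\\z≡a) ⟩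
    √ (a ∙ (a \\ z))  ≡⟨ ≡.cong √ (\\-leftDividesˡ a z) ⟩
    √ z               ∎

  Σᴿ Σᴳ : Fin n → (Fin n × Fin n → ℤ) → ℤ
  Σᴿ z h = ΣR n _∙_ z (curry h)
  Σᴳ z h = Σ[ n ] (λ a → h (a , a \\ z))

  Σᴿ-as-Σᴳ : ∀ z h → Σᴿ z h ≡ Σᴳ z h - h (√ z , √ z)
  Σᴿ-as-Σᴳ z h = begin
    Σᴿ z h
      ≡⟨ as-graph ⟩
    Σ[ n ] (λ a → Σ[ n ] (λ b → δ b (a \\ z) * (h (a , b) - δ a (√ z) * h (a , b))))
      ≡⟨ Σ.cong (λ a → Σ-δ (a \\ z) (λ b → h (a , b) - δ a (√ z) * h (a , b))) ⟩
    Σ[ n ] (λ a → h (a , a \\ z) - δ a (√ z) * h (a , a \\ z))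
      ≡⟨ Σ.sub-homo (λ a → h (a , a \\ z)) (λ a → δ a (√ z) * h (a , a \\ z)) ⟩
    Σᴳ z h - Σ[ n ] (λ a → δ a (√ z) * h (a , a \\ z))
      ≡⟨ ≡.cong (_-_ (Σᴳ z h)) (Σ-δ (√ z) (λ a → h (a , a \\ z))) ⟩
    Σᴳ z h - h (√ z , √ z \\ z)
      ≡⟨ ≡.cong (λ b → Σᴳ z h - h (√ z , b)) (√-\\ z) ⟩
    Σᴳ z h - h (√ z , √ z) ∎
    where
    cancels : ∀ x → + 0 ≡ + 1 * (x - + 1 * x)
    cancels = solve-∀
    keeps : ∀ x → x ≡ + 1 * (x - + 0 * x)
    keeps = solve-∀

    -- (a , b) ∈ R_z iff b = a \\ z and a ≠ √ z. The summand of ΣR is local to its definition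
    -- and cannot be named, so the left-hand side of summand is left to unification; mutual
    -- makes as-graph fix it first.
    mutual
      as-graph : Σᴿ z h ≡ Σ[ n ] (λ a → Σ[ n ] (λ b → δ b (a \\ z) * (h (a , b) - δ a (√ z) * h (a , b))))
      as-graph = Σ.cong (λ a → Σ.cong (summand a))

      summand : ∀ a b → _ ≡ δ b (a \\ z) * (h (a , b) - δ a (√ z) * h (a , b))
      summand a b with a ≟ b | a ∙ b ≟ z
      summand a _ | yes refl | _ with a ≟ √ z
      ... | yes refl rewrite √-\\ z | δ-refl (√ z) = cancels (h (√ z , √ z))
      ... | no  a≢√z rewrite δ-≢ (a≢√z ∘ \\-fixed⇒√ ∘ sym) = refl
      summand a b | no a≢b | yes a∙b≡z with y≈x\\z a b z a∙b≡z
      ... | refl rewrite δ-refl (a \\ z) | δ-≢ {a = a} {√ z} (λ { refl → a≢b (sym (√-\\ z)) }) =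
        keeps (h (a , a \\ z))
      summand a b | no _   | no a∙b≢z
        rewrite δ-≢ (λ b≡a\\z → a∙b≢z (trans (≡.cong (a ∙_) b≡a\\z) (\\-leftDividesˡ a z))) = refl

  isLinear-Σᴿ : ∀ z → IsLinear (Σᴿ z)
  isLinear-Σᴿ z =
    isLinear-resp (Σᴿ-as-Σᴳ z)
                  (isLinear-sub (isLinear-∘ isLinear-Σ (λ a → a , a \\ z)) (isLinear-eval (√ z , √ z)))

  pair-sum : (Fin n → ℤ) → Fin n × Fin n → ℤ
  pair-sum v (a , b) = v a + v b

  Σᴳ-pair-sum : ∀ {v} → Σ[ n ] v ≡ + 0 → ∀ z → Σᴳ z (pair-sum v) ≡ + 0
  Σᴳ-pair-sum {v} Σv≡0 z = begin
    Σ[ n ] (λ a → v a + v (a \\ z))          ≡⟨ Σ.+-homo v (v ∘ (_\\ z)) ⟩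
    Σ[ n ] v + Σ[ n ] (v ∘ (_\\ z))          ≡⟨ ≡.cong (_+_ (Σ[ n ] v)) (Σ-reindex (_\\ z) (_\\ z) (\\-involutive z) (\\-involutive z) v) ⟩
    Σ[ n ] v + Σ[ n ] v                      ≡⟨ cong₂ _+_ Σv≡0 Σv≡0 ⟩
    + 0                                      ∎

  module _ (w w′ : Fin n → ℤ) (Σw≡0 : Σ[ n ] w ≡ + 0) (Σw′≡0 : Σ[ n ] w′ ≡ + 0) where

    private
      p q pq : Fin n × Fin n → ℤ
      p = pair-sum w
      q = pair-sum w′
      pq x = p x * q x
      ww′ : Fin n → ℤ
      ww′ a = w a * w′ a

    ΣR²-difference : ∀ z →
      ΣR n _∙_ z (λ a b → ΣR n _∙_ z (λ c d → (w a + w b - w c - w d) * (w′ a + w′ b - w′ c - w′ d)))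
        ≡ + 2 * (+ n - + 1) * Σᴳ z pq - + 8 * + n * (w (√ z) * w′ (√ z))
    ΣR²-difference z = begin
      (Σᴿ z ⊗ Σᴿ z) (λ ((a , b) , (c , d)) → (w a + w b - w c - w d) * (w′ a + w′ b - w′ c - w′ d))
        ≡⟨ R².cong (λ ((a , b) , (c , d)) → regroup (w a) (w b) (w c) (w d) (w′ a) (w′ b) (w′ c) (w′ d)) ⟩
      (Σᴿ z ⊗ Σᴿ z) (λ (x , y) → (p x - p y) * (q x - q y))
        ≡⟨ ⊗-difference-product (isLinear-Σᴿ z) p q ⟩
      + 2 * (Σᴿ z (λ _ → + 1) * Σᴿ z pq) - + 2 * (Σᴿ z p * Σᴿ z q)
        ≡⟨ cong₂ (λ s t → + 2 * s - + 2 * t)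
             (cong₂ _*_ (Σᴿ-as-Σᴳ z (λ _ → + 1)) (Σᴿ-as-Σᴳ z pq))
             (cong₂ _*_ (Σᴿ-as-Σᴳ z p) (Σᴿ-as-Σᴳ z q)) ⟩
      + 2 * ((Σ[ n ] (λ _ → + 1) - + 1) * (Σᴳ z pq - pq (r , r)))
        - + 2 * ((Σᴳ z p - p (r , r)) * (Σᴳ z q - q (r , r)))
        ≡⟨ cong₂ (λ s t → + 2 * ((s - + 1) * (Σᴳ z pq - pq (r , r))) - + 2 * t)
             (Σ-one n)
             (cong₂ (λ s t → (s - p (r , r)) * (t - q (r , r))) (Σᴳ-pair-sum Σw≡0 z) (Σᴳ-pair-sum Σw′≡0 z)) ⟩
      + 2 * ((+ n - + 1) * (Σᴳ z pq - (u + u) * (u′ + u′))) - + 2 * ((+ 0 - (u + u)) * (+ 0 - (u′ + u′)))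
        ≡⟨ collect (+ n) (Σᴳ z pq) u u′ ⟩
      + 2 * (+ n - + 1) * Σᴳ z pq - + 8 * + n * (u * u′) ∎
      where
      module R² = IsLinear (isLinear-⊗ (isLinear-Σᴿ z) (isLinear-Σᴿ z))
      r : Fin n
      r = √ z
      u u′ : ℤ
      u = w r
      u′ = w′ r
      regroup : ∀ a b c d a′ b′ c′ d′ →
        (a + b - c - d) * (a′ + b′ - c′ - d′) ≡ ((a + b) - (c + d)) * ((a′ + b′) - (c′ + d′))
      regroup = solve-∀
      collect : ∀ m x y y′ →
        + 2 * ((m - + 1) * (x - (y + y) * (y′ + y′))) - + 2 * ((+ 0 - (y + y)) * (+ 0 - (y′ + y′)))
          ≡ + 2 * (m - + 1) * x - + 8 * m * (y * y′)
      collect = solve-∀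

    Σ-Σᴳ : Σ[ n ] (λ z → Σᴳ z pq) ≡ + 2 * (+ n * Σ[ n ] ww′)
    Σ-Σᴳ = begin
      Σ[ n ] (λ z → Σᴳ z pq)
        ≡⟨ Σ-comm (λ z a → pq (a , a \\ z)) ⟩
      Σ[ n ] (λ a → Σ[ n ] (λ z → pq (a , a \\ z)))
        ≡⟨ Σ.cong (λ a → Σ-reindex (a \\_) (a ∙_) (\\-leftDividesʳ a) (\\-leftDividesˡ a) (λ b → pq (a , b))) ⟩
      (Σ[ n ] ⊗ Σ[ n ]) (λ (a , b) → (w a + w b) * (w′ a + w′ b))
        ≡⟨ ⊗-sum-product isLinear-Σ w w′ ⟩
      + 2 * (Σ[ n ] (λ _ → + 1) * Σ[ n ] ww′) + + 2 * (Σ[ n ] w * Σ[ n ] w′)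
        ≡⟨ cong₂ (λ s t → + 2 * (s * Σ[ n ] ww′) + + 2 * t) (Σ-one n) (cong₂ _*_ Σw≡0 Σw′≡0) ⟩
      + 2 * (+ n * Σ[ n ] ww′) + + 0
        ≡⟨ +-identityʳ _ ⟩
      + 2 * (+ n * Σ[ n ] ww′) ∎

    Σ-ΣR²-difference :
      Σ[ n ] (λ z → ΣR n _∙_ z (λ a b → ΣR n _∙_ z (λ c d →
        (w a + w b - w c - w d) * (w′ a + w′ b - w′ c - w′ d))))
        ≡ + 4 * + n * (+ n - + 3) * Σ[ n ] (λ a → w a * w′ a)
    Σ-ΣR²-difference = begin
      Σ[ n ] (λ z → ΣR n _∙_ z (λ a b → ΣR n _∙_ z (λ c d →
        (w a + w b - w c - w d) * (w′ a + w′ b - w′ c - w′ d))))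
        ≡⟨ Σ.cong ΣR²-difference ⟩
      Σ[ n ] (λ z → c₁ * Σᴳ z pq - c₂ * ww′ (√ z))
        ≡⟨ Σ.sub-homo (λ z → c₁ * Σᴳ z pq) (λ z → c₂ * ww′ (√ z)) ⟩
      Σ[ n ] (λ z → c₁ * Σᴳ z pq) - Σ[ n ] (λ z → c₂ * ww′ (√ z))
        ≡⟨ cong₂ _-_ (Σ.*-homo c₁ (λ z → Σᴳ z pq)) (Σ.*-homo c₂ (ww′ ∘ √)) ⟩
      c₁ * Σ[ n ] (λ z → Σᴳ z pq) - c₂ * Σ[ n ] (ww′ ∘ √)
        ≡⟨ cong₂ (λ s t → c₁ * s - c₂ * t) Σ-Σᴳ (Σ-reindex √ (λ a → a ∙ a) √-of-square √-squared ww′) ⟩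
      c₁ * (+ 2 * (+ n * Σ[ n ] ww′)) - c₂ * Σ[ n ] ww′
        ≡⟨ collect (+ n) (Σ[ n ] ww′) ⟩
      + 4 * + n * (+ n - + 3) * Σ[ n ] ww′ ∎
      where
      c₁ c₂ : ℤ
      c₁ = + 2 * (+ n - + 1)
      c₂ = + 8 * + n
      collect : ∀ m d → + 2 * (m - + 1) * (+ 2 * (m * d)) - + 8 * m * d ≡ + 4 * m * (m - + 3) * d
      collect = solve-∀

Σ-column : ∀ {n} (j : Fin n) → Σ[ suc n ] (λ a → A (suc n) a j) ≡ + 0
Σ-column {n} j = begin
  Σ[ suc n ] (λ a → δ a fzero - δ a (fsuc j))
    ≡⟨ Σ.sub-homo {suc n} (λ a → δ a fzero) (λ a → δ a (fsuc j)) ⟩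
  Σ[ suc n ] (λ a → δ a fzero) - Σ[ suc n ] (λ a → δ a (fsuc j))
    ≡⟨ cong₂ _-_ (Σ-δ-one {suc n} fzero) (Σ-δ-one (fsuc j)) ⟩
  + 1 - + 1 ∎

lemma2p6 : (n : ℕ) → 5 ≤ n → ¬ (2 ∣ n) →
    (_∙_ : Fin n → Fin n → Fin n) (ε : Fin n) (_⁻¹ : Fin n → Fin n) →
    IsAbelianGroup _≡_ _∙_ ε _⁻¹ → toℕ ε ≡ 0 →
    (j k : Fin (n ∸ 1)) →
    LHS n _∙_ j k ≡ + 4 * + n * (+ n - + 3) * dotCol n j k
lemma2p6 zero    _ _   _ _ _ _ _ () _
lemma2p6 (suc n) _ odd _ _ _ isAbelianGroup _ j k =
  OddOrderAbelianGroup.Σ-ΣR²-difference odd isAbelianGroup (column j) (column k) (Σ-column j) (Σ-column k)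
  where
  column : Fin n → Fin (suc n) → ℤ
  column j a = A (suc n) a j
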